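{- Let $\alpha<\beta<\gamma$ be distinct primes, let $G=\langle a\rangle$ be a cyclic group of order $\alpha^2\beta^2\gamma^2$, and let $C=\{x\in G : |x|\in\{\alpha^2,\beta^2,\gamma^2\}\}$. Let $Cay_{p^2}(G,C)$ be the simple undirected graph with vertex set $G$ in which two distinct vertices $x,y$ are adjacent if and only if $xy^{ -1}\in C$. Then $Cay_{p^2}(G,C)$ is Hamiltonian if $\alpha=2$, and semi-Hamiltonian if $\alpha>2$.
   Context: $|x|$ denotes the order of the element $x$ in $G$. A graph is Hamiltonian if it contains a cycle passing through every vertex exactly once; it is semi-Hamiltonian if it contains a path visiting every vertex exactly once. -}

module Defs where

open import Data.Nat using (ℕ; zero; suc; _+_; _*_; _∸_; _^_; _≤_; _<_)
open import Data.Nat.Divisibility using (_∣_)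
open import Data.Fin using (Fin; toℕ)
open import Data.Product using (Σ; _×_)
open import Data.Sum using (_⊎_)
open import Function.Definitions using (Bijective)
open import Relation.Binary.PropositionalEquality using (_≡_; _≢_)

-- The cyclic group of order n is modelled as ℤ/nℤ, with elements Fin n
-- (residues 0..n-1) under addition mod n; the generator a is the residue 1.

-- x - y in ℤ/nℤ, represented by a natural number congruent to it mod n
-- (not reduced mod n; only divisibility by n is ever used).
diff : (n : ℕ) → Fin n → Fin n → ℕ
diff n x y = toℕ x + (n ∸ toℕ y)

HasOrder : (n d k : ℕ) → Set
HasOrder n d k =
  (0 < k) × (n ∣ k * d) × (∀ j → 0 < j → n ∣ j * d → k ≤ j)

InC : (n α β γ d : ℕ) → Set
InC n α β γ d = HasOrder n d (α ^ 2) ⊎ HasOrder n d (β ^ 2) ⊎ HasOrder n d (γ ^ 2)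

CayAdj : (n α β γ : ℕ) → Fin n → Fin n → Set
CayAdj n α β γ x y = (x ≢ y) × InC n α β γ (diff n x y)

HamiltonianPath : (n : ℕ) → (Fin n → Fin n → Set) → Set
HamiltonianPath n Adj =
  Σ (Fin n → Fin n) λ σ →
    Bijective _≡_ _≡_ σ ×
    (∀ i j → toℕ j ≡ suc (toℕ i) → Adj (σ i) (σ j))

SemiHamiltonian : (n : ℕ) → (Fin n → Fin n → Set) → Set
SemiHamiltonian = HamiltonianPath

Hamiltonian : (n : ℕ) → (Fin n → Fin n → Set) → Set
Hamiltonian n Adj =
  (3 ≤ n) ×
  Σ (Fin n → Fin n) λ σ →
    Bijective _≡_ _≡_ σ ×
    (∀ i j → toℕ j ≡ suc (toℕ i) → Adj (σ i) (σ j)) ×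
    (∀ i j → toℕ i ≡ n ∸ 1 → toℕ j ≡ 0 → Adj (σ i) (σ j))

{-# OPTIONS --safe #-}
module Submission where

open import Defs
open import Data.Nat using (ℕ; zero; suc; pred; _+_; _*_; _∸_; _^_; _≤_; _<_; NonZero; >-nonZero; >-nonZero⁻¹; z≤n; s≤s)
open import Data.Nat.Properties hiding (_≟_)
open import Data.Nat.DivMod
open import Data.Nat.Divisibility
open import Data.Nat.Primality using (Prime; euclidsLemma; prime⇒nonZero; prime⇒nonTrivial; ¬prime[1])
open import Data.Nat.Divisibility.Core using (hasNonTrivialDivisor)
open import Data.Fin using (Fin; toℕ; punchOut; _≟_)
open import Data.Fin.Properties using (toℕ-fromℕ<; toℕ-injective; toℕ<n; punchOut-injective; any?; injective⇒≤)
open import Data.Product using (∃-syntax; _,_; _×_; proj₁; proj₂)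
open import Data.Sum using (_⊎_; inj₁; inj₂; [_,_]′)
import Data.Sum as Sum
open import Function.Base using (_∘_)
open import Function.Bundles using (_⇔_; mk⇔; Equivalence)
open import Function.Definitions using (Injective; Surjective; Bijective)
open import Relation.Nullary using (yes; no; contradiction)
open import Relation.Binary.Definitions using (tri<; tri≈; tri>)
open import Relation.Binary.PropositionalEquality
open import Data.Nat.Tactic.RingSolver using (solve-∀)

-- The elements a = β²γ², b = α²γ², c = α²β² have orders α², β², γ², and by the
-- Chinese remainder theorem r ↦ r·a + q·b + s·c is a bijection from the box
-- [0, α²) × [0, β²) × [0, γ²) onto ℤ/n.  Traversing the box in boustrophedon order
-- (each row and each plane alternately forwards and backwards) changes one coordinate
-- by ±1 at a time, so consecutive vertices differ by ±a, ±b or ±c, all in C: this is a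
-- Hamiltonian path.  It ends in the last plane r = α² − 1 at the point q = s = 0 when
-- α² is even, i.e. at (α² − 1)·a, which is adjacent to the starting vertex 0.

injective⇒surjective : ∀ {n} {f : Fin n → Fin n} → Injective _≡_ _≡_ f → Surjective _≡_ _≡_ f
injective⇒surjective {suc m} {f} f-inj y with any? (λ x → f x ≟ y)
... | yes (x , fx≡y) = x , λ { refl → fx≡y }
... | no ∄x = contradiction (injective⇒≤ g-inj) (n≮n m)
  where
  y≢f : ∀ x → y ≢ f x
  y≢f x y≡fx = ∄x (x , sym y≡fx)
  g : Fin (suc m) → Fin m
  g x = punchOut (y≢f x)
  g-inj : Injective _≡_ _≡_ g
  g-inj eq = f-inj (punchOut-injective (y≢f _) (y≢f _) eq)

module _ {n : ℕ} .{{_ : NonZero n}} where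

  %-+-congʳ : ∀ {x y} z → x % n ≡ y % n → (x + z) % n ≡ (y + z) % n
  %-+-congʳ {x} {y} z eq = begin
    (x + z) % n             ≡⟨ %-distribˡ-+ x z n ⟩
    (x % n + z % n) % n     ≡⟨ cong (λ t → (t + z % n) % n) eq ⟩
    (y % n + z % n) % n     ≡⟨ %-distribˡ-+ y z n ⟨
    (y + z) % n             ∎
    where open ≡-Reasoning

  -- adding z * pred n turns z + w into w + z * n, which is w modulo n
  %-+-cancelˡ : ∀ z {x y} → (z + x) % n ≡ (z + y) % n → x % n ≡ y % n
  %-+-cancelˡ z {x} {y} eq = begin
    x % n                         ≡⟨ unshift x ⟩
    ((z + x) + z * pred n) % n    ≡⟨ %-+-congʳ (z * pred n) eq ⟩
    ((z + y) + z * pred n) % n    ≡⟨ unshift y ⟨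
    y % n                         ∎
    where
    open ≡-Reasoning
    unshift : ∀ w → w % n ≡ ((z + w) + z * pred n) % n
    unshift w = begin
      w % n                          ≡⟨ [m+kn]%n≡m%n w z n ⟨
      (w + z * n) % n                ≡⟨ cong (λ m → (w + z * m) % n) (suc-pred n) ⟨
      (w + z * suc (pred n)) % n     ≡⟨ cong (_% n) (reassoc w z (pred n)) ⟩
      ((z + w) + z * pred n) % n     ∎
      where
      reassoc : ∀ w z p → w + z * suc p ≡ (z + w) + z * p
      reassoc = solve-∀

  %≡%+⇒∣ : ∀ x {y} → x % n ≡ (x + y) % n → n ∣ y
  %≡%+⇒∣ x {y} eq = m%n≡0⇒n∣m y n (trans (sym (%-+-cancelˡ x (trans (cong (_% n) (+-identityʳ x)) eq))) (m*n%n≡0 0 n))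

  ∣⇒%≡ : ∀ {d} .{{_ : NonZero d}} → d ∣ n → ∀ {x y} → x % n ≡ y % n → x % d ≡ y % d
  ∣⇒%≡ {d} d∣n {x} {y} eq = begin
    x % d        ≡⟨ m∣n⇒o%n%m≡o%m d n x d∣n ⟨
    x % n % d    ≡⟨ cong (_% d) eq ⟩
    y % n % d    ≡⟨ m∣n⇒o%n%m≡o%m d n y d∣n ⟩
    y % d        ∎
    where open ≡-Reasoning

InjectiveOn : (n : ℕ) .{{_ : NonZero n}} → ℕ → (ℕ → ℕ) → Set
InjectiveOn n N f = ∀ i j → i < N → j < N → f i % n ≡ f j % n → i ≡ j

*-injectiveOn : ∀ {d u} .{{_ : NonZero d}} → (∀ δ → d ∣ δ * u → d ∣ δ) → InjectiveOn d d (_* u)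
*-injectiveOn {d} {u} cancel i j i<d j<d eq =
  [ (λ i≤j → ordered i≤j j<d eq) , (λ j≤i → sym (ordered j≤i i<d (sym eq))) ]′ (≤-total i j)
  where
  ordered : ∀ {i j} → i ≤ j → j < d → (i * u) % d ≡ (j * u) % d → i ≡ j
  ordered {i} i≤j j<d eq with m≤n⇒∃[o]m+o≡n i≤j
  ... | δ , refl = sym (trans (cong (i +_) δ≡0) (+-identityʳ i))
    where
    d∣δ : d ∣ δ
    d∣δ = cancel δ (%≡%+⇒∣ (i * u) (trans eq (cong (_% d) (*-distribʳ-+ u i δ))))
    δ≡0 : δ ≡ 0
    δ≡0 = trans (sym (m<n⇒m%n≡m (≤-<-trans (m≤n+m δ i) j<d))) (n∣m⇒m%n≡0 δ d d∣δ)

prime∤prime : ∀ {p q} → Prime p → Prime q → p ≢ q → p ∤ q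
prime∤prime {p} {q} pp pq p≢q p∣q with <-cmp p q
... | tri< p<q _ _ = Prime.notComposite pq (hasNonTrivialDivisor {{prime⇒nonTrivial pp}} p<q p∣q)
... | tri≈ _ p≡q _ = p≢q p≡q
... | tri> _ _ q<p = contradiction (∣⇒≤ {{prime⇒nonZero pq}} p∣q) (<⇒≱ q<p)

prime∤* : ∀ {p m n} → Prime p → p ∤ m → p ∤ n → p ∤ m * n
prime∤* {m = m} {n} pp p∤m p∤n p∣mn = [ p∤m , p∤n ]′ (euclidsLemma m n pp p∣mn)

prime∤^ : ∀ {p m} → Prime p → p ∤ m → ∀ e → p ∤ m ^ e
prime∤^ pp p∤m zero    p∣1 = ¬prime[1] (subst Prime (∣1⇒≡1 p∣1) pp)
prime∤^ pp p∤m (suc e) = prime∤* pp p∤m (prime∤^ pp p∤m e)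

prime^∣*⇒∣ : ∀ {p u} → Prime p → p ∤ u → ∀ e {δ} → p ^ e ∣ δ * u → p ^ e ∣ δ
prime^∣*⇒∣         pp p∤u zero    {δ} _ = 1∣ δ
prime^∣*⇒∣ {p} {u} pp p∤u (suc e) {δ} p^[1+e]∣δu with euclidsLemma δ u pp (m*n∣⇒m∣ p (p ^ e) p^[1+e]∣δu)
... | inj₂ p∣u = contradiction p∣u p∤u
... | inj₁ (divides k refl) = subst (_∣ k * p) (*-comm (p ^ e) p) (*-monoˡ-∣ p p^e∣k)
  where
  instance _ = prime⇒nonZero pp
  p^e∣k : p ^ e ∣ k
  p^e∣k = prime^∣*⇒∣ pp p∤u e (*-cancelˡ-∣ p (subst (p * p ^ e ∣_) (reassoc k p u) p^[1+e]∣δu))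
    where
    reassoc : ∀ k p u → k * p * u ≡ p * (k * u)
    reassoc = solve-∀

prime²-cancel : ∀ {p q r} → Prime p → Prime q → Prime r → p ≢ q → p ≢ r →
                ∀ δ → p ^ 2 ∣ δ * (q ^ 2 * r ^ 2) → p ^ 2 ∣ δ
prime²-cancel pp pq pr p≢q p≢r δ =
  prime^∣*⇒∣ pp (prime∤* pp (prime∤^ pp (prime∤prime pp pq p≢q) 2) (prime∤^ pp (prime∤prime pp pr p≢r) 2)) 2 {δ}


SameAnnihilators : ℕ → ℕ → ℕ → Set
SameAnnihilators n d e = ∀ j → n ∣ j * d ⇔ n ∣ j * e

hasOrder-resp : ∀ {n d e k} → SameAnnihilators n d e → HasOrder n d k → HasOrder n e k
hasOrder-resp {k = k} same (0<k , n∣kd , least) =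
  0<k , Equivalence.to (same k) n∣kd , λ j 0<j n∣je → least j 0<j (Equivalence.from (same j) n∣je)

hasOrder-cofactor : ∀ {n k u} .{{_ : NonZero u}} → 0 < k → n ≡ k * u → HasOrder n u k
hasOrder-cofactor {u = u} 0<k refl =
  0<k , ∣-refl , λ j 0<j k*u∣j*u → ∣⇒≤ {{>-nonZero 0<j}} (*-cancelʳ-∣ u k*u∣j*u)

sameAnnihilators-%≡ : ∀ {n d e} .{{_ : NonZero n}} → d % n ≡ e % n → SameAnnihilators n d e
sameAnnihilators-%≡ {n} {d} {e} eq j = mk⇔
  (λ n∣jd → m%n≡0⇒n∣m _ n (trans (sym jd≡je) (n∣m⇒m%n≡0 _ n n∣jd)))
  (λ n∣je → m%n≡0⇒n∣m _ n (trans jd≡je (n∣m⇒m%n≡0 _ n n∣je)))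
  where
  jd≡je : (j * d) % n ≡ (j * e) % n
  jd≡je = begin
    (j * d) % n                ≡⟨ %-distribˡ-* j d n ⟩
    ((j % n) * (d % n)) % n    ≡⟨ cong (λ t → ((j % n) * t) % n) eq ⟩
    ((j % n) * (e % n)) % n    ≡⟨ %-distribˡ-* j e n ⟨
    (j * e) % n                ∎
    where open ≡-Reasoning

sameAnnihilators-∣+ : ∀ {n d e} → n ∣ d + e → SameAnnihilators n d e
sameAnnihilators-∣+ {n} {d} {e} n∣d+e j = mk⇔
  (λ n∣jd → ∣m+n∣m⇒∣n n∣jd+je n∣jd)
  (λ n∣je → ∣m+n∣m⇒∣n (subst (n ∣_) (+-comm (j * d) (j * e)) n∣jd+je) n∣je)
  where
  n∣jd+je : n ∣ j * d + j * e
  n∣jd+je = subst (n ∣_) (*-distribˡ-+ j d e) (∣n⇒∣m*n j n∣d+e)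

ShiftMod : (n : ℕ) .{{_ : NonZero n}} → ℕ → ℕ → ℕ → Set
ShiftMod n u x y = (x + u) % n ≡ y % n ⊎ (y + u) % n ≡ x % n

Shift : ℕ → ℕ → ℕ → Set
Shift u x y = y ≡ x + u ⊎ x ≡ y + u

Step : (ℕ → Set) → ℕ → ℕ → Set
Step P x y = ∃[ u ] P u × Shift u x y

WalkOn : (ℕ → Set) → ℕ → (ℕ → ℕ) → Set
WalkOn P N f = ∀ i → suc i < N → Step P (f i) (f (suc i))

shift⇒shiftMod : ∀ {n} .{{_ : NonZero n}} {u x y} → Shift u x y → ShiftMod n u x y
shift⇒shiftMod {n} = Sum.map (cong (_% n) ∘ sym) (cong (_% n) ∘ sym)

step-translate : ∀ {P x y} t → Step P x y → Step P (t + x) (t + y)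
step-translate t (u , Pu , shift) = u , Pu , Sum.map translate translate shift
  where
  translate : ∀ {v w} → w ≡ v + u → t + w ≡ (t + v) + u
  translate refl = sym (+-assoc t _ u)

step-sym : ∀ {P x y} → Step P x y → Step P y x
step-sym (u , Pu , shift) = u , Pu , Sum.swap shift

module _ {n : ℕ} .{{_ : NonZero n}} where

  +-diff-mod : ∀ x y → (y + diff n (x mod n) (y mod n)) % n ≡ x % n
  +-diff-mod x y = begin
    (y + diff n (x mod n) (y mod n)) % n   ≡⟨ cong (λ d → (y + d) % n) (cong₂ (λ a b → a + (n ∸ b)) (toℕ-fromℕ< (m%n<n x n)) (toℕ-fromℕ< (m%n<n y n))) ⟩
    (y + (x % n + (n ∸ y % n))) % n        ≡⟨ %-+-congʳ (x % n + (n ∸ y % n)) (sym (m%n%n≡m%n y n)) ⟩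
    (y % n + (x % n + (n ∸ y % n))) % n    ≡⟨ cong (_% n) (rotate (y % n) (x % n) (n ∸ y % n)) ⟩
    (x % n + ((n ∸ y % n) + y % n)) % n    ≡⟨ cong (λ t → (x % n + t) % n) (m∸n+n≡m (m%n≤n y n)) ⟩
    (x % n + n) % n                        ≡⟨ [m+n]%n≡m%n (x % n) n ⟩
    x % n % n                              ≡⟨ m%n%n≡m%n x n ⟩
    x % n                                  ∎
    where
    open ≡-Reasoning
    rotate : ∀ a b c → a + (b + c) ≡ b + (c + a)
    rotate = solve-∀

  hasOrder-diff : ∀ {u x y k} → ShiftMod n u x y → HasOrder n u k → HasOrder n (diff n (x mod n) (y mod n)) k
  hasOrder-diff {u} {x} {y} (inj₁ x+u≡y) = hasOrder-resp (sameAnnihilators-∣+ n∣u+d)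
    where
    d = diff n (x mod n) (y mod n)
    n∣u+d : n ∣ u + d
    n∣u+d = %≡%+⇒∣ y (begin
      y % n                ≡⟨ x+u≡y ⟨
      (x + u) % n          ≡⟨ %-+-congʳ u (+-diff-mod x y) ⟨
      ((y + d) + u) % n    ≡⟨ cong (_% n) (+-assoc y d u) ⟩
      (y + (d + u)) % n    ≡⟨ cong (λ t → (y + t) % n) (+-comm d u) ⟩
      (y + (u + d)) % n    ∎)
      where open ≡-Reasoning
  hasOrder-diff {u} {x} {y} (inj₂ y+u≡x) =
    hasOrder-resp (sameAnnihilators-%≡ (%-+-cancelˡ y (trans y+u≡x (sym (+-diff-mod x y)))))

  inC-diff : ∀ {α β γ u x y} → ShiftMod n u x y → InC n α β γ u → InC n α β γ (diff n (x mod n) (y mod n))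
  inC-diff shift = Sum.map (hasOrder-diff shift) (Sum.map (hasOrder-diff shift) (hasOrder-diff shift))

module CayleyWalk {n α β γ : ℕ} .{{_ : NonZero n}} (f : ℕ → ℕ)
  (f-injective : InjectiveOn n n f) (f-walk : WalkOn (InC n α β γ) n f) where

  σ : Fin n → Fin n
  σ i = f (toℕ i) mod n

  σ-injective : Injective _≡_ _≡_ σ
  σ-injective {i} {j} σi≡σj = toℕ-injective (f-injective (toℕ i) (toℕ j) (toℕ<n i) (toℕ<n j)
    (trans (sym (toℕ-fromℕ< _)) (trans (cong toℕ σi≡σj) (toℕ-fromℕ< _))))

  σ-bijective : Bijective _≡_ _≡_ σ
  σ-bijective = σ-injective , injective⇒surjective σ-injective

  adjacent : ∀ {i j u} → toℕ i ≢ toℕ j → InC n α β γ u → ShiftMod n u (f (toℕ i)) (f (toℕ j)) → CayAdj n α β γ (σ i) (σ j)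
  adjacent i≢j u∈C shift = (λ σi≡σj → i≢j (cong toℕ (σ-injective σi≡σj))) , inC-diff {α = α} {β} {γ} shift u∈C

  consecutive-adjacent : ∀ i j → toℕ j ≡ suc (toℕ i) → CayAdj n α β γ (σ i) (σ j)
  consecutive-adjacent i j j≡1+i with f-walk (toℕ i) (subst (_< n) j≡1+i (toℕ<n j))
  ... | u , u∈C , shift = adjacent (λ i≡j → 1+n≢n (trans (sym j≡1+i) (sym i≡j))) u∈C
                            (shift⇒shiftMod (subst (Shift u (f (toℕ i)) ∘ f) (sym j≡1+i) shift))

  hamiltonianPath : HamiltonianPath n (CayAdj n α β γ)
  hamiltonianPath = σ , σ-bijective , consecutive-adjacent

  hamiltonian : 3 ≤ n → (∃[ u ] InC n α β γ u × (f (n ∸ 1) + u) % n ≡ f 0 % n) → Hamiltonian n (CayAdj n α β γ)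
  hamiltonian 3≤n (u , u∈C , closes) = 3≤n , σ , σ-bijective , consecutive-adjacent , last-adjacent
    where
    last-adjacent : ∀ i j → toℕ i ≡ n ∸ 1 → toℕ j ≡ 0 → CayAdj n α β γ (σ i) (σ j)
    last-adjacent i j i≡n-1 j≡0 = adjacent i≢j u∈C (inj₁ (subst₂ (λ a b → (f a + u) % n ≡ f b % n) (sym i≡n-1) (sym j≡0) closes))
      where
      i≢j : toℕ i ≢ toℕ j
      i≢j i≡j = <⇒≢ (m<n⇒0<n∸m (≤-trans (s≤s (s≤s z≤n)) 3≤n)) (sym (trans (sym i≡n-1) (trans i≡j j≡0)))

module Snake (a M : ℕ) .{{_ : NonZero M}} (p : ℕ → ℕ) where

  layer : ℕ → ℕ → ℕ
  layer zero          k = p k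
  layer (suc zero)    k = p (pred M ∸ k)
  layer (suc (suc r)) k = layer r k

  snake : ℕ → ℕ
  snake i = i / M * a + layer (i / M) (i % M)

  pred<M : pred M < M
  pred<M = ≤-reflexive (suc-pred M)

  layer-turn : ∀ r → layer (suc r) 0 ≡ layer r (pred M)
  layer-turn zero          = refl
  layer-turn (suc zero)    = cong p (sym (n∸n≡0 (pred M)))
  layer-turn (suc (suc r)) = layer-turn r

  layer-odd : ∀ t k → layer (suc (t * 2)) k ≡ p (pred M ∸ k)
  layer-odd zero    k = refl
  layer-odd (suc t) k = layer-odd t k

  snake-digits : ∀ r k → k < M → snake (r * M + k) ≡ r * a + layer r k
  snake-digits r k k<M = cong₂ (λ q k → q * a + layer q k) [rM+k]/M≡r [rM+k]%M≡k
    where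
    open ≡-Reasoning
    [rM+k]/M≡r : (r * M + k) / M ≡ r
    [rM+k]/M≡r = begin
      (r * M + k) / M        ≡⟨ +-distrib-/-∣ˡ k (n∣m*n r) ⟩
      r * M / M + k / M      ≡⟨ cong₂ _+_ (m*n/n≡m r M) (m<n⇒m/n≡0 k<M) ⟩
      r + 0                  ≡⟨ +-identityʳ r ⟩
      r                      ∎
    [rM+k]%M≡k : (r * M + k) % M ≡ k
    [rM+k]%M≡k = begin
      (r * M + k) % M        ≡⟨ cong (_% M) (+-comm (r * M) k) ⟩
      (k + r * M) % M        ≡⟨ [m+kn]%n≡m%n k r M ⟩
      k % M                  ≡⟨ m<n⇒m%n≡m k<M ⟩
      k                      ∎

  i≡[i/M]*M+i%M : ∀ i → i ≡ i / M * M + i % M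
  i≡[i/M]*M+i%M i = trans (m≡m%n+[m/n]*n i M) (+-comm (i % M) _)

  layer-walk : ∀ {P} → WalkOn P M p → ∀ r → WalkOn P M (layer r)
  layer-walk walk zero          = walk
  layer-walk {P} walk (suc zero) i 1+i<M =
    subst (λ k → Step P (p k) (p (pred M ∸ suc i))) (sym M-i≡1+[M-1-i])
      (step-sym (walk (pred M ∸ suc i) (≤-<-trans (≤-trans (≤-reflexive (sym M-i≡1+[M-1-i])) (m∸n≤m (pred M) i)) pred<M)))
    where
    M-i≡1+[M-1-i] : pred M ∸ i ≡ suc (pred M ∸ suc i)
    M-i≡1+[M-1-i] = +-∸-assoc 1 (<⇒≤pred 1+i<M)
  layer-walk walk (suc (suc r)) = layer-walk walk r

  snake-step : ∀ {P} → WalkOn P M p → P a → ∀ r k → k < M → Step P (snake (r * M + k)) (snake (suc (r * M + k)))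
  snake-step {P} walk Pa r k k<M with m≤n⇒m<n∨m≡n k<M
  ... | inj₁ 1+k<M = subst₂ (Step P) (sym (snake-digits r k k<M)) (sym within)
                       (step-translate (r * a) (layer-walk walk r k 1+k<M))
    where
    within : snake (suc (r * M + k)) ≡ r * a + layer r (suc k)
    within = trans (cong snake (sym (+-suc (r * M) k))) (snake-digits r (suc k) 1+k<M)
  ... | inj₂ 1+k≡M = a , Pa , inj₁ turn
    where
    open ≡-Reasoning
    next-row : suc (r * M + k) ≡ suc r * M + 0
    next-row = begin
      suc (r * M + k)    ≡⟨ +-suc (r * M) k ⟨
      r * M + suc k      ≡⟨ cong (r * M +_) 1+k≡M ⟩
      r * M + M          ≡⟨ +-comm (r * M) M ⟩
      suc r * M          ≡⟨ +-identityʳ (suc r * M) ⟨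
      suc r * M + 0      ∎
    turn : snake (suc (r * M + k)) ≡ snake (r * M + k) + a
    turn = begin
      snake (suc (r * M + k))       ≡⟨ cong snake next-row ⟩
      snake (suc r * M + 0)         ≡⟨ snake-digits (suc r) 0 (>-nonZero⁻¹ M) ⟩
      suc r * a + layer (suc r) 0   ≡⟨ cong (suc r * a +_) (trans (layer-turn r) (cong (layer r) (cong pred (sym 1+k≡M)))) ⟩
      suc r * a + layer r k         ≡⟨ rearrange (r * a) a (layer r k) ⟩
      (r * a + layer r k) + a       ≡⟨ cong (_+ a) (snake-digits r k k<M) ⟨
      snake (r * M + k) + a         ∎
      where
      rearrange : ∀ x a z → (a + x) + z ≡ (x + z) + a
      rearrange = solve-∀

  snake-walk : ∀ {P} → WalkOn P M p → P a → ∀ i → Step P (snake i) (snake (suc i))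
  snake-walk {P} walk Pa i = subst (λ j → Step P (snake j) (snake (suc j))) (sym (i≡[i/M]*M+i%M i))
    (snake-step walk Pa (i / M) (i % M) (m%n<n i M))

  layer-∣ : ∀ {d} → (∀ k → d ∣ p k) → ∀ r k → d ∣ layer r k
  layer-∣ d∣p zero          k = d∣p k
  layer-∣ d∣p (suc zero)    k = d∣p (pred M ∸ k)
  layer-∣ d∣p (suc (suc r)) k = layer-∣ d∣p r k

  snake-∣ : ∀ {d} → d ∣ a → (∀ k → d ∣ p k) → ∀ i → d ∣ snake i
  snake-∣ d∣a d∣p i = ∣m∣n⇒∣m+n (∣n⇒∣m*n (i / M) d∣a) (layer-∣ d∣p (i / M) (i % M))

  layer-injectiveOn : ∀ {n} .{{_ : NonZero n}} → InjectiveOn n M p → ∀ r → InjectiveOn n M (layer r)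
  layer-injectiveOn p-inj zero          = p-inj
  layer-injectiveOn p-inj (suc zero)    i j i<M j<M eq =
    ∸-cancelˡ-≡ (<⇒≤pred i<M) (<⇒≤pred j<M) (p-inj _ _ (reflected<M i) (reflected<M j) eq)
    where
    reflected<M : ∀ k → pred M ∸ k < M
    reflected<M k = ≤-<-trans (m∸n≤m (pred M) k) pred<M
  layer-injectiveOn p-inj (suc (suc r)) = layer-injectiveOn p-inj r

  snake-injectiveOn : ∀ {n A} .{{_ : NonZero n}} .{{_ : NonZero A}} → A ∣ n → InjectiveOn A A (_* a) →
                      (∀ k → A ∣ p k) → InjectiveOn n M p → InjectiveOn n (A * M) snake
  snake-injectiveOn {n} {A} A∣n a-inj A∣p p-inj i j i<AM j<AM eq = begin
    i                      ≡⟨ i≡[i/M]*M+i%M i ⟩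
    i / M * M + i % M      ≡⟨ cong₂ (λ r k → r * M + k) (proj₁ same-digits) (proj₂ same-digits) ⟩
    j / M * M + j % M      ≡⟨ i≡[i/M]*M+i%M j ⟨
    j                      ∎
    where
    open ≡-Reasoning
    digits-injective : ∀ {r r′ k k′} → r < A → r′ < A → k < M → k′ < M →
                       snake (r * M + k) % n ≡ snake (r′ * M + k′) % n → r ≡ r′ × k ≡ k′
    digits-injective {r} {r′} {k} {k′} r<A r′<A k<M k′<M eq = r≡r′ , k≡k′
      where
      eq′ : (r * a + layer r k) % n ≡ (r′ * a + layer r′ k′) % n
      eq′ = subst₂ (λ x y → x % n ≡ y % n) (snake-digits r k k<M) (snake-digits r′ k′ k′<M) eq
      r≡r′ : r ≡ r′
      r≡r′ = a-inj r r′ r<A r′<A (begin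
        (r * a) % A                   ≡⟨ %-remove-+ʳ (r * a) (layer-∣ A∣p r k) ⟨
        (r * a + layer r k) % A       ≡⟨ ∣⇒%≡ A∣n eq′ ⟩
        (r′ * a + layer r′ k′) % A    ≡⟨ %-remove-+ʳ (r′ * a) (layer-∣ A∣p r′ k′) ⟩
        (r′ * a) % A                  ∎)
      k≡k′ : k ≡ k′
      k≡k′ = layer-injectiveOn p-inj r k k′ k<M k′<M
        (%-+-cancelˡ (r * a) (subst (λ s → (r * a + layer r k) % n ≡ (s * a + layer s k′) % n) (sym r≡r′) eq′))
    same-digits : i / M ≡ j / M × i % M ≡ j % M
    same-digits = digits-injective (m<n*o⇒m/o<n i<AM) (m<n*o⇒m/o<n j<AM) (m%n<n i M) (m%n<n j M)
      (subst₂ (λ x y → snake x % n ≡ snake y % n) (i≡[i/M]*M+i%M i) (i≡[i/M]*M+i%M j) eq)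

  snake-closes : ∀ t → snake (suc t * 2 * M ∸ 1) + a ≡ suc t * 2 * a + p 0
  snake-closes t = begin
    snake (suc r * M ∸ 1) + a              ≡⟨ cong (λ i → snake i + a) last-index ⟩
    snake (r * M + pred M) + a             ≡⟨ cong (_+ a) (snake-digits r (pred M) pred<M) ⟩
    (r * a + layer r (pred M)) + a         ≡⟨ cong (λ z → (r * a + z) + a) (trans (layer-odd t (pred M)) (cong p (n∸n≡0 (pred M)))) ⟩
    (r * a + p 0) + a                      ≡⟨ rearrange (r * a) a (p 0) ⟩
    suc r * a + p 0                        ∎
    where
    open ≡-Reasoning
    r = suc (t * 2)
    last-index : suc r * M ∸ 1 ≡ r * M + pred M
    last-index = begin
      (M + r * M) ∸ 1                ≡⟨ cong (λ m → (m + r * M) ∸ 1) (suc-pred M) ⟨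
      (suc (pred M) + r * M) ∸ 1     ≡⟨ +-comm (pred M) (r * M) ⟩
      r * M + pred M                 ∎
    rearrange : ∀ x a z → (x + z) + a ≡ (a + x) + z
    rearrange = solve-∀

module Boustrophedon (α β γ : ℕ) .{{_ : NonZero α}} .{{_ : NonZero β}} .{{_ : NonZero γ}}
  (α²-cancel : ∀ δ → α ^ 2 ∣ δ * (β ^ 2 * γ ^ 2) → α ^ 2 ∣ δ)
  (β²-cancel : ∀ δ → β ^ 2 ∣ δ * (α ^ 2 * γ ^ 2) → β ^ 2 ∣ δ)
  (γ²-cancel : ∀ δ → γ ^ 2 ∣ δ * (α ^ 2 * β ^ 2) → γ ^ 2 ∣ δ) where

  A B G n : ℕ
  A = α ^ 2
  B = β ^ 2
  G = γ ^ 2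
  n = A * B * G

  instance
    A≢0 : NonZero A
    A≢0 = m^n≢0 α 2
    B≢0 : NonZero B
    B≢0 = m^n≢0 β 2
    G≢0 : NonZero G
    G≢0 = m^n≢0 γ 2
    BG≢0 : NonZero (B * G)
    BG≢0 = m*n≢0 B G
    AG≢0 : NonZero (A * G)
    AG≢0 = m*n≢0 A G
    AB≢0 : NonZero (A * B)
    AB≢0 = m*n≢0 A B
    n≢0 : NonZero n
    n≢0 = m*n≢0 (A * B) G

  a b c : ℕ
  a = B * G
  b = A * G
  c = A * B

  a∈C : InC n α β γ a
  a∈C = inj₁ (hasOrder-cofactor (>-nonZero⁻¹ A) (*-assoc A B G))

  b∈C : InC n α β γ b
  b∈C = inj₂ (inj₁ (hasOrder-cofactor (>-nonZero⁻¹ B) (swap A B G)))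
    where
    swap : ∀ x y z → x * y * z ≡ y * (x * z)
    swap = solve-∀

  c∈C : InC n α β γ c
  c∈C = inj₂ (inj₂ (hasOrder-cofactor (>-nonZero⁻¹ G) (*-comm (A * B) G)))

  line plane box : ℕ → ℕ
  line s = s * c
  plane = Snake.snake b G line
  box = Snake.snake a (B * G) plane

  box-walk : WalkOn (InC n α β γ) n box
  box-walk i _ = Snake.snake-walk a (B * G) plane plane-walk a∈C i
    where
    line-walk : WalkOn (InC n α β γ) G line
    line-walk s _ = c , c∈C , inj₁ (+-comm c (s * c))
    plane-walk : WalkOn (InC n α β γ) (B * G) plane
    plane-walk k _ = Snake.snake-walk b G line line-walk b∈C k

  box-injective : InjectiveOn n n box
  box-injective = subst (λ N → InjectiveOn n N box) (sym (*-assoc A B G))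
    (Snake.snake-injectiveOn a (B * G) plane (∣m⇒∣m*n G (m∣m*n B)) (*-injectiveOn α²-cancel) A∣plane plane-injective)
    where
    line-injective : InjectiveOn n G line
    line-injective i j i<G j<G eq = *-injectiveOn γ²-cancel i j i<G j<G (∣⇒%≡ (n∣m*n (A * B)) eq)
    plane-injective : InjectiveOn n (B * G) plane
    plane-injective = Snake.snake-injectiveOn b G line (∣m⇒∣m*n G (n∣m*n A)) (*-injectiveOn β²-cancel)
      (λ s → ∣n⇒∣m*n s (n∣m*n A)) line-injective
    A∣plane : ∀ k → A ∣ plane k
    A∣plane = Snake.snake-∣ b G line (m∣m*n G) (λ s → ∣n⇒∣m*n s (m∣m*n B))

  hamiltonianPath : HamiltonianPath n (CayAdj n α β γ)
  hamiltonianPath = CayleyWalk.hamiltonianPath {α = α} {β} {γ} box box-injective box-walk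

  hamiltonian : ∀ t → α ^ 2 ≡ suc (suc t) * 2 → Hamiltonian n (CayAdj n α β γ)
  hamiltonian t A≡[2+t]*2 = CayleyWalk.hamiltonian {α = α} {β} {γ} box box-injective box-walk 3≤n (a , a∈C , closes)
    where
    open ≡-Reasoning
    3≤n : 3 ≤ n
    3≤n = ≤-trans (subst (3 ≤_) (sym A≡[2+t]*2) (s≤s (s≤s (s≤s z≤n)))) (≤-trans (m≤m*n A B) (m≤m*n (A * B) G))
    closes : (box (n ∸ 1) + a) % n ≡ box 0 % n
    closes = begin
      (box (n ∸ 1) + a) % n                        ≡⟨ cong (λ m → (box (m ∸ 1) + a) % n) n≡[2+t]*2*a ⟩
      (box (suc (suc t) * 2 * (B * G) ∸ 1) + a) % n ≡⟨ cong (_% n) (Snake.snake-closes a (B * G) plane (suc t)) ⟩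
      (suc (suc t) * 2 * a + plane 0) % n            ≡⟨ %-remove-+ˡ (plane 0) (∣-reflexive n≡[2+t]*2*a) ⟩
      plane 0 % n                                    ≡⟨ cong (_% n) (Snake.snake-digits a (B * G) plane 0 0 (>-nonZero⁻¹ (B * G))) ⟨
      box 0 % n                                     ∎
      where
      n≡[2+t]*2*a : n ≡ suc (suc t) * 2 * a
      n≡[2+t]*2*a = trans (*-assoc A B G) (cong (_* a) A≡[2+t]*2)

proposition2p17 : (α β γ : ℕ) → Prime α → Prime β → Prime γ → α < β → β < γ →
    ((α ≡ 2) → Hamiltonian ((α ^ 2) * (β ^ 2) * (γ ^ 2)) (CayAdj ((α ^ 2) * (β ^ 2) * (γ ^ 2)) α β γ)) ×
    ((2 < α) → SemiHamiltonian ((α ^ 2) * (β ^ 2) * (γ ^ 2)) (CayAdj ((α ^ 2) * (β ^ 2) * (γ ^ 2)) α β γ))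
proposition2p17 α β γ pα pβ pγ α<β β<γ = (λ α≡2 → hamiltonian 0 (cong (_^ 2) α≡2)) , (λ _ → hamiltonianPath)
  where
  instance
    α≢0 = prime⇒nonZero pα
    β≢0 = prime⇒nonZero pβ
    γ≢0 = prime⇒nonZero pγ
  α≢β = <⇒≢ α<β
  β≢γ = <⇒≢ β<γ
  α≢γ = <⇒≢ (<-trans α<β β<γ)
  open Boustrophedon α β γ (prime²-cancel pα pβ pγ α≢β α≢γ) (prime²-cancel pβ pα pγ (≢-sym α≢β) β≢γ)
                           (prime²-cancel pγ pα pβ (≢-sym α≢γ) (≢-sym β≢γ))
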